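{- Let $s$ be a positive integer, let $H$ be a connected graph and let $P=xy$ be an edge such that $V(H)\cap V(P)=\{x\}$. Let $HxP$ denote the graph with vertex set $V(H)\cup\{y\}$ and edge set $E(H)\cup\{xy\}$. If $(HxP)^2$ has a $[2,2s]$-factor, then $H^2$ has a spanning $s$-trail between some vertex $x'\in N_H[x]$ and some vertex $x''\in N_H(x)$.
   Context: All graphs are finite, simple and undirected. The square $G^2$ of a graph $G$ is the graph on $V(G)$ in which two distinct vertices are adjacent if and only if their distance in $G$ is at most two. A $[2,2s]$-factor of a graph is a connected spanning subgraph in which every vertex has even degree at most $2s$. A trail between $u_0$ and $u_r$ is a sequence $u_0e_1u_1\cdots e_ru_r$ of vertices and distinct edges with $e_i=u_{i-1}u_i$; it is spanning if it contains every vertex of the graph. An $s$-trail between $u_0$ and $u_r$ is a trail starting at $u_0$ and ending at $u_r$ in which every vertex is visited at most $s$ times. $N_H(x)$ is the set of neighbours of $x$ in $H$ and $N_H[x]=N_H(x)\cup\{x\}$. -}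

module Defs where

open import Data.Nat using (ℕ; zero; suc; _+_; _*_; _≤_)
open import Data.Nat.Divisibility using (_∣_)
open import Data.Fin using (Fin; zero; suc; _≟_)
open import Data.Bool using (Bool; true; false; _∧_; _∨_; not; if_then_else_)
open import Data.Maybe using (Maybe; just; nothing)
import Data.Maybe as Maybe
open import Data.List using (List; []; _∷_; allFin; map)
open import Data.Bool.ListAction using (any)
open import Data.Nat.ListAction using (sum)
open import Data.List.Membership.Propositional using (_∈_)
open import Data.List.Relation.Unary.All using (All)
open import Data.List.Relation.Unary.AllPairs using (AllPairs)
open import Data.Product using (_×_; _,_; proj₁; proj₂; Σ)
open import Data.Sum using (_⊎_)
open import Relation.Binary.PropositionalEquality using (_≡_)
open import Relation.Nullary using (¬_; yes; no)
open import Relation.Nullary.Decidable using (⌊_⌋)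

Adj : ℕ → Set
Adj n = Fin n → Fin n → Bool

record IsSimple {n : ℕ} (G : Adj n) : Set where
  field
    sym   : ∀ u v → G u v ≡ G v u
    irrefl : ∀ u → G u u ≡ false

_==_ : ∀ {n} → Fin n → Fin n → Bool
u == v = ⌊ u ≟ v ⌋

Square : ∀ {n} → Adj n → Adj n
Square {n} G u v = not (u == v) ∧ (G u v ∨ any (λ w → G u w ∧ G w v) (allFin n))

data Reachable {n : ℕ} (G : Adj n) : Fin n → Fin n → Set where
  here : ∀ {u} → Reachable G u u
  step : ∀ {u w v} → G u w ≡ true → Reachable G w v → Reachable G u v

Connected : ∀ {n} → Adj n → Set
Connected {n} G = ∀ (u v : Fin n) → Reachable G u v

_⊆ᴳ_ : ∀ {n} → Adj n → Adj n → Set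
F ⊆ᴳ G = ∀ u v → F u v ≡ true → G u v ≡ true

degree : ∀ {n} → Adj n → Fin n → ℕ
degree {n} G u = sum (map (λ v → if G u v then 1 else 0) (allFin n))

record Factor {n : ℕ} (s : ℕ) (G : Adj n) : Set where
  field
    F          : Adj n
    simple     : IsSimple F
    sub        : F ⊆ᴳ G
    connected  : Connected F
    even       : ∀ u → 2 ∣ degree F u
    bounded    : ∀ u → degree F u ≤ 2 * s

-- The graph HxP: vertices of H are 'just a', the new vertex y is 'nothing'
-- (the last element of Fin (suc n)); the only new edge is xy.
lowerM : ∀ {n} → Fin (suc n) → Maybe (Fin n)
lowerM {zero}  zero    = nothing
lowerM {suc n} zero    = just zero
lowerM {suc n} (suc i) = Maybe.map suc (lowerM i)

attach : ∀ {n} → Adj n → Fin n → Maybe (Fin n) → Maybe (Fin n) → Bool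
attach H x (just a) (just b) = H a b
attach H x (just a) nothing  = a == x
attach H x nothing  (just b) = b == x
attach H x nothing  nothing  = false

HxP : ∀ {n} → Adj n → Fin n → Adj (suc n)
HxP H x u v = attach H x (lowerM u) (lowerM v)

-- trails given by their vertex sequence u₀ ∷ rest
edgesOf : ∀ {n} → Fin n → List (Fin n) → List (Fin n × Fin n)
edgesOf a []       = []
edgesOf a (b ∷ bs) = (a , b) ∷ edgesOf b bs

endOf : ∀ {n} → Fin n → List (Fin n) → Fin n
endOf a []       = a
endOf a (b ∷ bs) = endOf b bs

SameEdge : ∀ {n} → Fin n × Fin n → Fin n × Fin n → Set
SameEdge (a , b) (c , d) = (a ≡ c × b ≡ d) ⊎ (a ≡ d × b ≡ c)

visits : ∀ {n} → Fin n → List (Fin n) → ℕ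
visits v []       = 0
visits v (u ∷ us) = (if u == v then 1 else 0) + visits v us

record SpanningSTrail {n : ℕ} (G : Adj n) (s : ℕ) (a b : Fin n) : Set where
  field
    rest     : List (Fin n)
    edges    : All (λ e → G (proj₁ e) (proj₂ e) ≡ true) (edgesOf a rest)
    distinct : AllPairs (λ e f → ¬ SameEdge e f) (edgesOf a rest)
    ends     : endOf a rest ≡ b
    spanning : ∀ v → v ∈ (a ∷ rest)
    atMost   : ∀ v → visits v (a ∷ rest) ≤ s

-- Let F be the [2,2s]-factor of (HxP)² and y the new vertex. Every neighbour of y in (HxP)²
-- lies in N_H[x], so any two of them are adjacent in (HxP)². While deg_F y ≥ 4, an Euler tour
-- of F passes through y at least twice, as y a₁ … b₁ y a₂ … b₂ y …. Replacing the two edges from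
-- y to one of a₁, b₁ and one of a₂, b₂ by the edge between them, if it is missing from F, or
-- else deleting the triangle y a₁ a₂, keeps F connected and even with all degrees away from y
-- unchanged or smaller, and lowers deg_F y by two. Once deg_F y = 2 the Euler tour is y a … b y,
-- and a … b visits every vertex of H at most s times. Its edges lie in H², because a detour
-- through y only joins x to itself, and since a ≠ b one of its ends is a neighbour of x.
module Submission where

open import Defs
open import Data.Nat using (ℕ; zero; suc; _+_; _*_; _≤_; _<_; z≤n; s≤s)
open import Data.Nat.Properties hiding (_≟_)
open import Data.Nat.Divisibility using (_∣_; ∣m+n∣m⇒∣n; m∣m*n; ∣1⇒≡1; ∣-refl)
open import Data.Nat.ListAction using (sum)
open import Data.Nat.Tactic.RingSolver using (solve-∀)
open import Data.Fin using (Fin; zero; suc; _≟_; fromℕ; inject₁)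
import Data.Fin.Properties as Fin
open import Data.Fin.Relation.Unary.Top using (view; ‵fromℕ; ‵inject₁)
open import Data.Bool using (Bool; true; false; _∧_; _∨_; not; if_then_else_)
import Data.Bool.Properties as Bool
open import Data.Bool.ListAction using (any)
open import Data.Maybe using (just; nothing; fromMaybe)
open import Data.List using (List; []; _∷_; [_]; length; _++_; allFin; map; filter; cartesianProduct)
open import Data.List.Properties using (++-assoc; length-++; ++-identityʳ; length-++-sucʳ; length-++-comm)
open import Data.List.Membership.Propositional using (_∈_; _∉_)
open import Data.List.Membership.Propositional.Properties
  using (∈-++⁺ˡ; ∈-++⁺ʳ; ∈-++⁻; ∈-∃++; ∈-allFin; ∈-filter⁺; ∈-filter⁻; ∈-cartesianProduct⁺; ∈-map⁺)
import Data.List.Membership.DecPropositional as DecMembership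
open import Data.List.Relation.Binary.Subset.Propositional using (_⊆_)
open import Data.List.Relation.Unary.All as All using (All; []; _∷_)
import Data.List.Relation.Unary.All.Properties as All
open import Data.List.Relation.Unary.Any using (here; there)
open import Data.List.Relation.Unary.AllPairs as AllPairs using (AllPairs; []; _∷_)
import Data.List.Relation.Unary.AllPairs.Properties as AllPairs
open import Data.List.Relation.Unary.Unique.Propositional using (Unique)
import Data.List.Relation.Unary.Unique.Propositional.Properties as Unique
open import Data.Product using (Σ; _×_; _,_; proj₁; proj₂; swap)
import Data.Product as Product
open import Data.Sum using (_⊎_; inj₁; inj₂)
import Data.Sum as Sum
open import Data.Empty using (⊥-elim)
open import Function using (_∘_)
open import Relation.Binary.PropositionalEquality hiding ([_])
open import Relation.Nullary using (¬_; yes; no; Dec; does; ¬?; _×-dec_; _⊎-dec_)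

≡⇒== : ∀ {n} {u v : Fin n} → u ≡ v → (u == v) ≡ true
≡⇒== {u = u} {v} u≡v with u ≟ v
... | yes _ = refl
... | no u≢v = ⊥-elim (u≢v u≡v)

≢⇒== : ∀ {n} {u v : Fin n} → u ≢ v → (u == v) ≡ false
≢⇒== {u = u} {v} u≢v with u ≟ v
... | yes u≡v = ⊥-elim (u≢v u≡v)
... | no _ = refl

==⇒≡ : ∀ {n} {u v : Fin n} → (u == v) ≡ true → u ≡ v
==⇒≡ {u = u} {v} eq with u ≟ v
... | yes u≡v = u≡v

true≢false : true ≢ false
true≢false ()

-- Counting

indicator : Bool → ℕ
indicator b = if b then 1 else 0

count : ∀ {A : Set} → (A → Bool) → List A → ℕ
count p xs = sum (map (λ x → indicator (p x)) xs)

satisfies : ∀ {A : Set} (p : A → Bool) → List A → List A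
satisfies p = filter (λ x → p x Bool.≟ true)

count≡length-satisfies : ∀ {A : Set} (p : A → Bool) xs → count p xs ≡ length (satisfies p xs)
count≡length-satisfies p [] = refl
count≡length-satisfies p (x ∷ xs) with p x
... | true  = cong suc (count≡length-satisfies p xs)
... | false = count≡length-satisfies p xs

Unique-length-≤ : ∀ {A : Set} {xs ys : List A} → Unique xs → xs ⊆ ys → length xs ≤ length ys
Unique-length-≤ {xs = []} _ _ = z≤n
Unique-length-≤ {xs = x ∷ xs} (x∉xs ∷ xs!) xs⊆ys with ∈-∃++ (xs⊆ys (here refl))
... | ys₁ , ys₂ , refl = subst (suc (length xs) ≤_) (sym (length-++-sucʳ ys₁ x ys₂))
  (s≤s (Unique-length-≤ xs! xs⊆ys₁++ys₂))
  where
  xs⊆ys₁++ys₂ : xs ⊆ ys₁ ++ ys₂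
  xs⊆ys₁++ys₂ {z} z∈xs with ∈-++⁻ ys₁ (xs⊆ys (there z∈xs))
  ... | inj₁ z∈ys₁ = ∈-++⁺ˡ z∈ys₁
  ... | inj₂ (here refl) = ⊥-elim (All.lookup x∉xs z∈xs refl)
  ... | inj₂ (there z∈ys₂) = ∈-++⁺ʳ ys₁ z∈ys₂

degree≡length-satisfies : ∀ {n} (G : Adj n) w → degree G w ≡ length (satisfies (G w) (allFin n))
degree≡length-satisfies {n} G w = count≡length-satisfies (G w) (allFin n)

degree-≥ : ∀ {n} (G : Adj n) w {L} → Unique L → All (λ z → G w z ≡ true) L → length L ≤ degree G w
degree-≥ G w L! adj = subst (_ ≤_) (sym (degree≡length-satisfies G w))
  (Unique-length-≤ L! λ {z} z∈L → ∈-filter⁺ _ (∈-allFin z) (All.lookup adj z∈L))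

degree-≤ : ∀ {n} (G : Adj n) w {L} → (∀ z → G w z ≡ true → z ∈ L) → degree G w ≤ length L
degree-≤ {n} G w nbrs = subst (_≤ _) (sym (degree≡length-satisfies G w))
  (Unique-length-≤ (Unique.filter⁺ _ (Unique.allFin⁺ n))
    λ z∈ → nbrs _ (proj₂ (∈-filter⁻ (λ z → G w z Bool.≟ true) {xs = allFin n} z∈)))

-- Trails

Edge : ℕ → Set
Edge m = Fin m × Fin m

EdgesIn : ∀ {m} → Adj m → List (Edge m) → Set
EdgesIn G = All (λ e → G (proj₁ e) (proj₂ e) ≡ true)

DistinctEdges : ∀ {m} → List (Edge m) → Set
DistinctEdges = AllPairs (λ e f → ¬ SameEdge e f)

SameEdge-refl : ∀ {m} (e : Edge m) → SameEdge e e
SameEdge-refl e = inj₁ (refl , refl)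

SameEdge-sym : ∀ {m} {e f : Edge m} → SameEdge e f → SameEdge f e
SameEdge-sym (inj₁ (refl , refl)) = inj₁ (refl , refl)
SameEdge-sym (inj₂ (refl , refl)) = inj₂ (refl , refl)

SameEdge-trans : ∀ {m} {e f g : Edge m} → SameEdge e f → SameEdge f g → SameEdge e g
SameEdge-trans (inj₁ (refl , refl)) ef = ef
SameEdge-trans (inj₂ (refl , refl)) (inj₁ (refl , refl)) = inj₂ (refl , refl)
SameEdge-trans (inj₂ (refl , refl)) (inj₂ (refl , refl)) = inj₁ (refl , refl)

AllPairs-++⁻ : ∀ {A : Set} {R : A → A → Set} xs {ys} → AllPairs R (xs ++ ys) →
  AllPairs R xs × AllPairs R ys × All (λ x → All (R x) ys) xs
AllPairs-++⁻ [] rs = [] , rs , []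
AllPairs-++⁻ (x ∷ xs) (r ∷ rs) with AllPairs-++⁻ xs rs | All.++⁻ xs r
... | rxs , rys , rxys | rx , rxy = rx ∷ rxs , rys , rxy ∷ rxys

AllPairs-swap-++ : ∀ {A : Set} {R : A → A → Set} → (∀ {x y} → R x y → R y x) → ∀ xs {ys} →
  AllPairs R (xs ++ ys) → AllPairs R (ys ++ xs)
AllPairs-swap-++ R-sym xs rs with AllPairs-++⁻ xs rs
... | rxs , rys , rxys = AllPairs.++⁺ rys rxs
  (All.tabulate λ y∈ → All.tabulate λ x∈ → R-sym (All.lookup (All.lookup rxys x∈) y∈))

All-swap-++ : ∀ {A : Set} {P : A → Set} xs {ys} → All P (xs ++ ys) → All P (ys ++ xs)
All-swap-++ xs ps with All.++⁻ xs ps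
... | pxs , pys = All.++⁺ pys pxs

edgesOf-++ : ∀ {m} (a : Fin m) xs ys → edgesOf a (xs ++ ys) ≡ edgesOf a xs ++ edgesOf (endOf a xs) ys
edgesOf-++ a [] ys = refl
edgesOf-++ a (x ∷ xs) ys = cong ((a , x) ∷_) (edgesOf-++ x xs ys)

endOf-++ : ∀ {m} (a : Fin m) xs ys → endOf a (xs ++ ys) ≡ endOf (endOf a xs) ys
endOf-++ a [] ys = refl
endOf-++ a (x ∷ xs) ys = endOf-++ x xs ys

endOf-∈ : ∀ {m} (a : Fin m) xs → endOf a xs ∈ a ∷ xs
endOf-∈ a [] = here refl
endOf-∈ a (x ∷ xs) = there (endOf-∈ x xs)

length-edgesOf : ∀ {m} (a : Fin m) xs → length (edgesOf a xs) ≡ length xs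
length-edgesOf a [] = refl
length-edgesOf a (x ∷ xs) = cong suc (length-edgesOf x xs)

∈-edgesOf⇒∈ : ∀ {m} {e : Edge m} a xs → e ∈ edgesOf a xs → proj₁ e ∈ a ∷ xs × proj₂ e ∈ a ∷ xs
∈-edgesOf⇒∈ a (x ∷ xs) (here refl) = here refl , there (here refl)
∈-edgesOf⇒∈ a (x ∷ xs) (there e∈) with ∈-edgesOf⇒∈ x xs e∈
... | u∈ , v∈ = there u∈ , there v∈

visits-++ : ∀ {m} (v : Fin m) xs ys → visits v (xs ++ ys) ≡ visits v xs + visits v ys
visits-++ v [] ys = refl
visits-++ v (x ∷ xs) ys = trans (cong (indicator (x == v) +_) (visits-++ v xs ys))
  (sym (+-assoc (indicator (x == v)) _ _))

neighboursAt : ∀ {m} → Fin m → Edge m → List (Fin m)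
neighboursAt w (u , v) = (if u == w then [ v ] else []) ++ (if v == w then [ u ] else [])

neighboursAlong : ∀ {m} → Fin m → List (Edge m) → List (Fin m)
neighboursAlong w [] = []
neighboursAlong w (e ∷ es) = neighboursAt w e ++ neighboursAlong w es

length-neighboursAt : ∀ {m} (w u v : Fin m) →
  length (neighboursAt w (u , v)) ≡ indicator (u == w) + indicator (v == w)
length-neighboursAt w u v with u == w | v == w
... | true  | true  = refl
... | true  | false = refl
... | false | true  = refl
... | false | false = refl

-- Handshake along a trail: every visit of w contributes two edge ends at w,
-- except at the two ends of the trail.
length-neighboursAlong : ∀ {m} (w a : Fin m) rest →
  length (neighboursAlong w (edgesOf a rest)) + indicator (a == w) + indicator (endOf a rest == w)
    ≡ 2 * visits w (a ∷ rest)
length-neighboursAlong w a [] = double (indicator (a == w))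
  where
  double : ∀ k → 0 + k + k ≡ 2 * (k + 0)
  double = solve-∀
length-neighboursAlong w a (b ∷ bs) = begin
  length (neighboursAt w (a , b) ++ N) + A + Z   ≡⟨ cong (λ k → k + A + Z) (length-++ (neighboursAt w (a , b))) ⟩
  length (neighboursAt w (a , b)) + L + A + Z    ≡⟨ cong (λ k → k + L + A + Z) (length-neighboursAt w a b) ⟩
  A + B + L + A + Z                              ≡⟨ regroup A B L Z ⟩
  2 * A + (L + B + Z)                            ≡⟨ cong (2 * A +_) (length-neighboursAlong w b bs) ⟩
  2 * A + 2 * visits w (b ∷ bs)                  ≡⟨ *-distribˡ-+ 2 A _ ⟨
  2 * (A + visits w (b ∷ bs))                    ∎
  where
  open ≡-Reasoning
  N = neighboursAlong w (edgesOf b bs)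
  A = indicator (a == w)
  B = indicator (b == w)
  L = length N
  Z = indicator (endOf b bs == w)
  regroup : ∀ A B L Z → A + B + L + A + Z ≡ 2 * A + (L + B + Z)
  regroup = solve-∀

neighboursAt-sound : ∀ {m} {w z : Fin m} e → z ∈ neighboursAt w e → SameEdge e (w , z)
neighboursAt-sound {w = w} (u , v) z∈ with u == w in u≡w | v == w in v≡w
neighboursAt-sound (u , v) (here refl) | true | _ = inj₁ (==⇒≡ u≡w , refl)
neighboursAt-sound (u , v) (there (here refl)) | true | true = inj₂ (refl , ==⇒≡ v≡w)
neighboursAt-sound (u , v) (here refl) | false | true = inj₂ (refl , ==⇒≡ v≡w)

neighboursAt-complete : ∀ {m} {w z : Fin m} e → SameEdge e (w , z) → z ∈ neighboursAt w e
neighboursAt-complete {w = w} (.w , z) (inj₁ (refl , refl)) rewrite ≡⇒== (refl {x = w}) = here refl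
neighboursAt-complete {w = w} (z , .w) (inj₂ (refl , refl)) rewrite ≡⇒== (refl {x = w}) =
  ∈-++⁺ʳ (if z == w then [ w ] else []) (here refl)

neighboursAlong-sound : ∀ {m} {w z : Fin m} es → z ∈ neighboursAlong w es →
  Σ (Edge m) λ e → e ∈ es × SameEdge e (w , z)
neighboursAlong-sound (e ∷ es) z∈ with ∈-++⁻ (neighboursAt _ e) z∈
... | inj₁ z∈e = e , here refl , neighboursAt-sound e z∈e
... | inj₂ z∈es with neighboursAlong-sound es z∈es
...   | f , f∈ , f≈ = f , there f∈ , f≈

neighboursAlong-complete : ∀ {m} {w z : Fin m} {e} es → e ∈ es → SameEdge e (w , z) → z ∈ neighboursAlong w es
neighboursAlong-complete (e ∷ es) (here refl) e≈ = ∈-++⁺ˡ (neighboursAt-complete e e≈)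
neighboursAlong-complete (f ∷ es) (there e∈) e≈ =
  ∈-++⁺ʳ (neighboursAt _ f) (neighboursAlong-complete es e∈ e≈)

adjacent⇒≢ : ∀ {m} {G : Adj m} → IsSimple G → ∀ {u v} → G u v ≡ true → u ≢ v
adjacent⇒≢ simple {u} Guv refl with trans (sym Guv) (IsSimple.irrefl simple u)
... | ()

neighboursAt-unique : ∀ {m} (w : Fin m) {u v} → u ≢ v → Unique (neighboursAt w (u , v))
neighboursAt-unique w {u} {v} u≢v with u == w in u≡w | v == w in v≡w
... | true  | true  = ⊥-elim (u≢v (trans (==⇒≡ u≡w) (sym (==⇒≡ v≡w))))
... | true  | false = [] ∷ []
... | false | true  = [] ∷ []
... | false | false = []

neighboursAlong-unique : ∀ {m} {G : Adj m} → IsSimple G → (w : Fin m) → ∀ {es} →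
  EdgesIn G es → DistinctEdges es → Unique (neighboursAlong w es)
neighboursAlong-unique simple w {[]} _ _ = []
neighboursAlong-unique simple w {(u , v) ∷ es} (Guv ∷ inG) (e≉es ∷ distinct) =
  AllPairs.++⁺ (neighboursAt-unique w (adjacent⇒≢ simple Guv)) (neighboursAlong-unique simple w inG distinct)
    (All.tabulate λ z∈e → All.tabulate λ z'∈es z≡z' →
      let f , f∈ , f≈ = neighboursAlong-sound es z'∈es
      in All.lookup e≉es f∈ (SameEdge-trans (neighboursAt-sound (u , v) z∈e)
                               (SameEdge-sym (subst (λ k → SameEdge f (w , k)) (sym z≡z') f≈))))

neighboursAlong-adjacent : ∀ {m} {G : Adj m} → IsSimple G → (w : Fin m) → ∀ {es} →
  EdgesIn G es → All (λ z → G w z ≡ true) (neighboursAlong w es)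
neighboursAlong-adjacent {G = G} simple w {es} inG = All.tabulate λ z∈ →
  let e , e∈ , e≈ = neighboursAlong-sound es z∈ in oriented e (All.lookup inG e∈) e≈
  where
  oriented : ∀ {z} e → G (proj₁ e) (proj₂ e) ≡ true → SameEdge e (w , z) → G w z ≡ true
  oriented e Ge (inj₁ (refl , refl)) = Ge
  oriented (u , v) Ge (inj₂ (refl , refl)) = trans (IsSimple.sym simple v u) Ge

length-neighboursAlong-≤-degree : ∀ {m} {G : Adj m} → IsSimple G → (w : Fin m) → ∀ {es} →
  EdgesIn G es → DistinctEdges es → length (neighboursAlong w es) ≤ degree G w
length-neighboursAlong-≤-degree {G = G} simple w inG distinct =
  degree-≥ G w (neighboursAlong-unique simple w inG distinct) (neighboursAlong-adjacent simple w inG)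

_∈?_ : ∀ {m} (z : Fin m) L → Dec (z ∈ L)
_∈?_ = DecMembership._∈?_ _≟_

-- Closed trails and Euler tours

IsTrail : ∀ {m} → Adj m → Fin m → List (Fin m) → Set
IsTrail G a rest = EdgesIn G (edgesOf a rest) × DistinctEdges (edgesOf a rest)

IsClosedTrail : ∀ {m} → Adj m → Fin m → List (Fin m) → Set
IsClosedTrail G a rest = IsTrail G a rest × endOf a rest ≡ a

record SpanningClosedTrail {m} (G : Adj m) (a : Fin m) : Set where
  field
    rest     : List (Fin m)
    closed   : IsClosedTrail G a rest
    spanning : ∀ t → t ∈ a ∷ rest

edgeBound : ℕ → ℕ
edgeBound m = length (cartesianProduct (allFin m) (allFin m))

length-≤-edgeBound : ∀ {m} {es : List (Edge m)} → DistinctEdges es → length es ≤ edgeBound m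
length-≤-edgeBound {m} distinct = Unique-length-≤
  (AllPairs.map (λ e≉f e≡f → e≉f (subst (SameEdge _) e≡f (SameEdge-refl _))) distinct)
  (λ {(u , v)} _ → ∈-cartesianProduct⁺ (∈-allFin u) (∈-allFin v))

length-trail-≤-edgeBound : ∀ {m} {G : Adj m} {a rest} → IsTrail G a rest → length rest ≤ edgeBound m
length-trail-≤-edgeBound {a = a} {rest} (_ , distinct) =
  subst (_≤ _) (length-edgesOf a rest) (length-≤-edgeBound distinct)

length-snoc : ∀ {A : Set} (xs : List A) x → length (xs ++ [ x ]) ≡ suc (length xs)
length-snoc xs x = trans (length-++ xs) (+-comm (length xs) 1)

trail-snoc : ∀ {m} {G : Adj m} {a rest z} → IsTrail G a rest → G (endOf a rest) z ≡ true →
  z ∉ neighboursAlong (endOf a rest) (edgesOf a rest) → IsTrail G a (rest ++ [ z ])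
trail-snoc {a = a} {rest} {z} (inG , distinct) Gwz z∉ rewrite edgesOf-++ a rest [ z ] =
  All.++⁺ inG (Gwz ∷ []) ,
  AllPairs.++⁺ distinct ([] ∷ [])
    (All.tabulate λ e∈ → (λ e≈ → z∉ (neighboursAlong-complete _ e∈ e≈)) ∷ [])

record Rotation {m} (G : Adj m) (a : Fin m) (rest : List (Fin m)) (u : Fin m) : Set where
  field
    rest'    : List (Fin m)
    closed'  : IsClosedTrail G u rest'
    length-≡ : length rest' ≡ length rest
    ⊆-to     : a ∷ rest ⊆ u ∷ rest'
    ⊆-from   : u ∷ rest' ⊆ a ∷ rest

rotate : ∀ {m} {G : Adj m} {a rest u} → IsClosedTrail G a rest → u ∈ a ∷ rest → Rotation G a rest u
rotate {rest = rest} closed (here refl) = record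
  { rest' = rest ; closed' = closed ; length-≡ = refl ; ⊆-to = λ x∈ → x∈ ; ⊆-from = λ x∈ → x∈ }
rotate {G = G} {a} {u = u} ((inG , distinct) , closes) (there u∈) with ∈-∃++ u∈
... | P , Q , refl = record
  { rest'    = Q ++ P ++ [ u ]
  ; closed'  = (subst (EdgesIn G) (sym new) (All-swap-++ E₁ (subst (EdgesIn G) old inG)) ,
                subst DistinctEdges (sym new)
                  (AllPairs-swap-++ (λ e≉f f≈e → e≉f (SameEdge-sym f≈e)) E₁ (subst DistinctEdges old distinct))) ,
               trans (endOf-++ u Q (P ++ [ u ])) (endOf-++ (endOf u Q) P [ u ])
  ; length-≡ = trans (length-++-comm Q (P ++ [ u ])) (cong length (++-assoc P [ u ] Q))
  ; ⊆-to     = to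
  ; ⊆-from   = from
  }
  where
  E₁ = edgesOf a (P ++ [ u ])
  E₂ = edgesOf u Q
  Q-ends-at-a : endOf u Q ≡ a
  Q-ends-at-a = trans (sym (endOf-++ (endOf a P) [ u ] Q)) (trans (sym (endOf-++ a P (u ∷ Q))) closes)
  old : edgesOf a (P ++ u ∷ Q) ≡ E₁ ++ E₂
  old = trans (cong (edgesOf a) (sym (++-assoc P [ u ] Q)))
          (trans (edgesOf-++ a (P ++ [ u ]) Q) (cong (λ k → E₁ ++ edgesOf k Q) (endOf-++ a P [ u ])))
  new : edgesOf u (Q ++ P ++ [ u ]) ≡ E₂ ++ E₁
  new = trans (edgesOf-++ u Q (P ++ [ u ])) (cong (λ k → E₂ ++ edgesOf k (P ++ [ u ])) Q-ends-at-a)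
  to : a ∷ P ++ u ∷ Q ⊆ u ∷ Q ++ P ++ [ u ]
  to (here refl) with endOf-∈ u Q
  ... | here eq = here (trans (sym Q-ends-at-a) eq)
  ... | there end∈Q = there (∈-++⁺ˡ (subst (_∈ Q) Q-ends-at-a end∈Q))
  to (there x∈) with ∈-++⁻ P x∈
  ... | inj₁ x∈P = there (∈-++⁺ʳ Q (∈-++⁺ˡ x∈P))
  ... | inj₂ (here refl) = here refl
  ... | inj₂ (there x∈Q) = there (∈-++⁺ˡ x∈Q)
  from : u ∷ Q ++ P ++ [ u ] ⊆ a ∷ P ++ u ∷ Q
  from (here refl) = there (∈-++⁺ʳ P (here refl))
  from (there x∈) with ∈-++⁻ Q x∈
  ... | inj₁ x∈Q = there (∈-++⁺ʳ P (there x∈Q))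
  ... | inj₂ x∈ with ∈-++⁻ P x∈
  ...   | inj₁ x∈P = there (∈-++⁺ˡ x∈P)
  ...   | inj₂ (here refl) = there (∈-++⁺ʳ P (here refl))

exitEdge : ∀ {m} {G : Adj m} {p t} (L : List (Fin m)) → Reachable G p t → p ∈ L → t ∉ L →
  Σ (Fin m) λ u → Σ (Fin m) λ v → u ∈ L × v ∉ L × G u v ≡ true
exitEdge L here p∈ t∉ = ⊥-elim (t∉ p∈)
exitEdge {p = p} L (step {w = w} Gpw w⇝t) p∈ t∉ with w ∈? L
... | yes w∈ = exitEdge L w⇝t w∈ t∉
... | no w∉ = p , w , p∈ , w∉ , Gpw

module Euler {m} (G : Adj m) (simple : IsSimple G) (even : ∀ u → 2 ∣ degree G u) where

  -- Parity: at the end w ≠ a of an open trail an odd number of edge ends is used,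
  -- while the degree of w is even.
  unusedEdgeAtEnd : ∀ {a rest} → IsTrail G a rest → endOf a rest ≢ a →
    Σ (Fin m) λ z → G (endOf a rest) z ≡ true × z ∉ neighboursAlong (endOf a rest) (edgesOf a rest)
  unusedEdgeAtEnd {a} {rest} (inG , distinct) open-trail
    with Fin.any? (λ z → (G (endOf a rest) z Bool.≟ true)
                         ×-dec ¬? (z ∈? neighboursAlong (endOf a rest) (edgesOf a rest)))
  ... | yes found = found
  ... | no none = ⊥-elim (2∤1 (∣m+n∣m⇒∣n 2∣L+1 (subst (2 ∣_) degree≡L (even w))))
    where
    w = endOf a rest
    L = neighboursAlong w (edgesOf a rest)
    all-used : ∀ z → G w z ≡ true → z ∈ L
    all-used z Gwz with z ∈? L
    ... | yes z∈ = z∈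
    ... | no z∉ = ⊥-elim (none (z , Gwz , z∉))
    degree≡L : degree G w ≡ length L
    degree≡L = ≤-antisym (degree-≤ G w all-used) (length-neighboursAlong-≤-degree simple w inG distinct)
    handshake : length L + 1 ≡ 2 * visits w (a ∷ rest)
    handshake with length-neighboursAlong w a rest
    ... | eq rewrite ≢⇒== {u = a} (λ a≡w → open-trail (sym a≡w)) | ≡⇒== (refl {x = w})
                   | +-identityʳ (length L) = eq
    2∣L+1 : 2 ∣ length L + 1
    2∣L+1 = subst (2 ∣_) (sym handshake) (m∣m*n (visits w (a ∷ rest)))
    2∤1 : ¬ 2 ∣ 1
    2∤1 2∣1 with ∣1⇒≡1 2∣1
    ... | ()

  -- Walk on along unused edges until the trail closes; the budget cannot run out,
  -- since a trail has at most edgeBound m edges.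
  closeUp : ∀ (budget : ℕ) {a rest} → IsTrail G a rest → edgeBound m ≤ length rest + budget →
    Σ (List (Fin m)) λ ext → IsClosedTrail G a (rest ++ ext)
  closeUp budget {a} {rest} trail bound with endOf a rest ≟ a
  ... | yes closes = [] , subst (IsClosedTrail G a) (sym (++-identityʳ rest)) (trail , closes)
  ... | no open-trail with unusedEdgeAtEnd trail open-trail
  ...   | z , Gwz , z∉ with trail-snoc trail Gwz z∉
  closeUp zero {rest = rest} _ bound | no _ | z , _ | trail' =
    ⊥-elim (1+n≰n (≤-trans (subst (_≤ _) (length-snoc rest z) (length-trail-≤-edgeBound trail'))
                            (subst (_ ≤_) (+-identityʳ _) bound)))
  closeUp (suc budget) {rest = rest} _ bound | no _ | z , _ | trail'
    with closeUp budget trail' (subst (edgeBound m ≤_) (trans (+-suc (length rest) budget)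
                                               (cong (_+ budget) (sym (length-snoc rest z)))) bound)
  ... | ext , closed = z ∷ ext , subst (IsClosedTrail G _) (++-assoc rest [ z ] ext) closed

  -- A closed trail missing a vertex t: leave its vertex set along a path to t,
  -- restart the trail at the exit point and close it up again.
  enlarge : Connected G → ∀ {a rest t} → IsClosedTrail G a rest → t ∉ a ∷ rest →
    Σ (Fin m) λ u → Σ (List (Fin m)) λ rest' →
      IsClosedTrail G u rest' × length rest < length rest' × a ∷ rest ⊆ u ∷ rest'
  enlarge connected {a} {rest} {t} closed t∉ with exitEdge (a ∷ rest) (connected a t) (here refl) t∉
  ... | u , v , u∈ , v∉ , Guv with rotate closed u∈
  ... | rotation with trail-snoc (proj₁ closed') (subst (λ k → G k v ≡ true) (sym (proj₂ closed')) Guv) v-fresh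
    where
    open Rotation rotation
    v-fresh : v ∉ neighboursAlong (endOf u rest') (edgesOf u rest')
    v-fresh v∈ with neighboursAlong-sound _ v∈
    ... | e , e∈ , e≈ with ∈-edgesOf⇒∈ u rest' e∈ | e≈
    ...   | _ , e₂∈ | inj₁ (_ , refl) = v∉ (⊆-from e₂∈)
    ...   | e₁∈ , _ | inj₂ (refl , _) = v∉ (⊆-from e₁∈)
  ... | trail' with closeUp (edgeBound m) trail' (m≤n+m _ _)
  ... | ext , closed'' = u , (rest' ++ [ v ]) ++ ext , closed'' , longer ,
                         λ x∈ → grow (⊆-to x∈)
    where
    open Rotation rotation
    longer : length rest < length ((rest' ++ [ v ]) ++ ext)
    longer = subst (_≤ length ((rest' ++ [ v ]) ++ ext)) (cong suc length-≡)
      (subst (suc (length rest') ≤_)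
        (sym (trans (length-++ (rest' ++ [ v ])) (cong (_+ length ext) (length-snoc rest' v))))
        (m≤m+n _ _))
    grow : u ∷ rest' ⊆ u ∷ (rest' ++ [ v ]) ++ ext
    grow (here eq) = here eq
    grow (there x∈) = there (∈-++⁺ˡ (∈-++⁺ˡ x∈))

  spanningFrom : Connected G → ∀ (budget : ℕ) {a rest} y → IsClosedTrail G a rest → y ∈ a ∷ rest →
    edgeBound m ≤ length rest + budget → SpanningClosedTrail G y
  spanningFrom connected budget {a} {rest} y closed y∈ bound with Fin.any? (λ t → ¬? (t ∈? (a ∷ rest)))
  ... | no none = record { rest = rest' ; closed = closed' ; spanning = spanning }
    where
    open Rotation (rotate closed y∈)
    spanning : ∀ t → t ∈ y ∷ rest'
    spanning t with t ∈? (a ∷ rest)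
    ... | yes t∈ = ⊆-to t∈
    ... | no t∉ = ⊥-elim (none (t , t∉))
  ... | yes (t , t∉) with enlarge connected closed t∉
  ... | u , rest' , closed' , longer , ⊆ with budget
  ...   | zero = ⊥-elim (<⇒≱ longer (≤-trans (length-trail-≤-edgeBound (proj₁ closed'))
                                               (subst (_ ≤_) (+-identityʳ _) bound)))
  ...   | suc budget' = spanningFrom connected budget' y closed' (⊆ y∈)
                          (≤-trans bound (subst (_≤ length rest' + budget') (sym (+-suc (length rest) budget'))
                                                (+-monoˡ-≤ budget' longer)))

  euler : Connected G → ∀ y → SpanningClosedTrail G y
  euler connected y = spanningFrom connected (edgeBound m) y (([] , []) , refl) (here refl) ≤-refl

-- The vertex sequence of a trail a ∷ rest walked backwards is endOf a rest ∷ reversed a rest.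
reversed : ∀ {m} → Fin m → List (Fin m) → List (Fin m)
reversed a [] = []
reversed a (b ∷ rest) = reversed b rest ++ [ a ]

reverseEdges : ∀ {m} → List (Edge m) → List (Edge m)
reverseEdges [] = []
reverseEdges (e ∷ es) = reverseEdges es ++ [ swap e ]

endOf-reversed : ∀ {m} (a : Fin m) rest → endOf (endOf a rest) (reversed a rest) ≡ a
endOf-reversed a [] = refl
endOf-reversed a (b ∷ rest) = endOf-++ (endOf b rest) (reversed b rest) [ a ]

edgesOf-reversed : ∀ {m} (a : Fin m) rest → edgesOf (endOf a rest) (reversed a rest) ≡ reverseEdges (edgesOf a rest)
edgesOf-reversed a [] = refl
edgesOf-reversed a (b ∷ rest) = trans (edgesOf-++ (endOf b rest) (reversed b rest) [ a ])
  (cong₂ _++_ (edgesOf-reversed b rest) (cong (λ k → [ (k , a) ]) (endOf-reversed b rest)))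

∈-reverseEdges : ∀ {m} {f : Edge m} es → f ∈ reverseEdges es → swap f ∈ es
∈-reverseEdges (e ∷ es) f∈ with ∈-++⁻ (reverseEdges es) f∈
... | inj₁ f∈es = there (∈-reverseEdges es f∈es)
... | inj₂ (here refl) = here refl

EdgesIn-reverseEdges : ∀ {m} {G : Adj m} → (∀ u v → G u v ≡ G v u) → ∀ {es} →
  EdgesIn G es → EdgesIn G (reverseEdges es)
EdgesIn-reverseEdges G-sym [] = []
EdgesIn-reverseEdges G-sym {(u , v) ∷ _} (Guv ∷ inG) =
  All.++⁺ (EdgesIn-reverseEdges G-sym inG) (trans (G-sym v u) Guv ∷ [])

DistinctEdges-reverseEdges : ∀ {m} {es : List (Edge m)} → DistinctEdges es → DistinctEdges (reverseEdges es)
DistinctEdges-reverseEdges {es = []} [] = []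
DistinctEdges-reverseEdges {es = e ∷ es} (e≉es ∷ distinct) =
  AllPairs.++⁺ (DistinctEdges-reverseEdges distinct) ([] ∷ [])
    (All.tabulate λ f∈ → (λ f≈e → All.lookup e≉es (∈-reverseEdges es f∈) (swap-≈ (SameEdge-sym f≈e))) ∷ [])
  where
  swap-≈ : ∀ {e f : Edge _} → SameEdge (swap e) f → SameEdge e (swap f)
  swap-≈ (inj₁ (refl , refl)) = inj₁ (refl , refl)
  swap-≈ (inj₂ (refl , refl)) = inj₂ (refl , refl)

IsTrail-reversed : ∀ {m} {G : Adj m} → (∀ u v → G u v ≡ G v u) → ∀ {a rest} →
  IsTrail G a rest → IsTrail G (endOf a rest) (reversed a rest)
IsTrail-reversed G-sym {a} {rest} (inG , distinct) rewrite edgesOf-reversed a rest =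
  EdgesIn-reverseEdges G-sym inG , DistinctEdges-reverseEdges distinct

visits-reversed : ∀ {m} (v a : Fin m) rest → visits v (endOf a rest ∷ reversed a rest) ≡ visits v (a ∷ rest)
visits-reversed v a [] = refl
visits-reversed v a (b ∷ rest) = begin
  E + visits v (reversed b rest ++ [ a ])     ≡⟨ cong (E +_) (visits-++ v (reversed b rest) [ a ]) ⟩
  E + (visits v (reversed b rest) + A)        ≡⟨ +-assoc E _ _ ⟨
  visits v (endOf b rest ∷ reversed b rest) + A ≡⟨ cong (_+ A) (visits-reversed v b rest) ⟩
  visits v (b ∷ rest) + A                     ≡⟨ +-comm (visits v (b ∷ rest)) A ⟩
  A + visits v (b ∷ rest)                     ≡⟨ cong (_+ visits v (b ∷ rest)) (+-identityʳ (indicator (a == v))) ⟩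
  visits v (a ∷ b ∷ rest)                     ∎
  where
  open ≡-Reasoning
  E = indicator (endOf b rest == v)
  A = visits v [ a ]

reversed-⊇ : ∀ {m} (a : Fin m) rest → a ∷ rest ⊆ endOf a rest ∷ reversed a rest
reversed-⊇ a [] v∈ = v∈
reversed-⊇ a (b ∷ rest) (here refl) = there (∈-++⁺ʳ (reversed b rest) (here refl))
reversed-⊇ a (b ∷ rest) (there v∈) with reversed-⊇ b rest v∈
... | here eq = here eq
... | there v∈' = there (∈-++⁺ˡ v∈')

reversed-⊆ : ∀ {m} (a : Fin m) rest → endOf a rest ∷ reversed a rest ⊆ a ∷ rest
reversed-⊆ a [] v∈ = v∈
reversed-⊆ a (b ∷ rest) (here refl) = there (endOf-∈ b rest)
reversed-⊆ a (b ∷ rest) (there v∈) with ∈-++⁻ (reversed b rest) v∈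
... | inj₁ v∈' = there (reversed-⊆ b rest (there v∈'))
... | inj₂ (here refl) = here refl

-- In a closed trail every visit of an inner vertex uses two of its edges.
visits-≤-degree : ∀ {m} {G : Adj m} → IsSimple G → ∀ {a rest} → IsClosedTrail G a rest →
  ∀ w → w ≢ a → 2 * visits w (a ∷ rest) ≤ degree G w
visits-≤-degree {G = G} simple {a} {rest} ((inG , distinct) , closes) w w≢a = subst (_≤ degree G w) handshake
  (length-neighboursAlong-≤-degree simple w inG distinct)
  where
  handshake : length (neighboursAlong w (edgesOf a rest)) ≡ 2 * visits w (a ∷ rest)
  handshake with length-neighboursAlong w a rest
  ... | eq rewrite closes | ≢⇒== (λ a≡w → w≢a (sym a≡w)) =
    trans (sym (trans (+-identityʳ _) (+-identityʳ _))) eq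

-- Changing one edge of a graph

sameEdge? : ∀ {m} (e f : Edge m) → Dec (SameEdge e f)
sameEdge? (u , v) (p , q) = ((u ≟ p) ×-dec (v ≟ q)) ⊎-dec ((u ≟ q) ×-dec (v ≟ p))

SameEdge-swap : ∀ {m} {u v : Fin m} {e} → SameEdge (u , v) e → SameEdge (v , u) e
SameEdge-swap (inj₁ (u≡p , v≡q)) = inj₂ (v≡q , u≡p)
SameEdge-swap (inj₂ (u≡q , v≡p)) = inj₁ (v≡p , u≡q)

module _ {A B : Set} {x y : B} where

  if-does-yes : (a? : Dec A) → A → (if does a? then x else y) ≡ x
  if-does-yes (yes _) _ = refl
  if-does-yes (no ¬a) a = ⊥-elim (¬a a)

  if-does-no : (a? : Dec A) → ¬ A → (if does a? then x else y) ≡ y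
  if-does-no (yes a) ¬a = ⊥-elim (¬a a)
  if-does-no (no _) _ = refl

-- Opaque, so that e, b and G stay inferable from goals about setEdge e b G u v.
opaque
  setEdge : ∀ {m} → Edge m → Bool → Adj m → Adj m
  setEdge e b G u v = if does (sameEdge? (u , v) e) then b else G u v

  setEdge-≈ : ∀ {m} {e : Edge m} {b G u v} → SameEdge (u , v) e → setEdge e b G u v ≡ b
  setEdge-≈ {e = e} {u = u} {v} = if-does-yes (sameEdge? (u , v) e)

  setEdge-≉ : ∀ {m} {e : Edge m} {b G u v} → ¬ SameEdge (u , v) e → setEdge e b G u v ≡ G u v
  setEdge-≉ {e = e} {u = u} {v} = if-does-no (sameEdge? (u , v) e)

setEdge-simple : ∀ {m} {p q : Fin m} {b G} → p ≢ q → IsSimple G → IsSimple (setEdge (p , q) b G)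
setEdge-simple {p = p} {q} {b} {G} p≢q simple = record { sym = symmetric ; irrefl = irreflexive }
  where
  symmetric : ∀ u v → setEdge (p , q) b G u v ≡ setEdge (p , q) b G v u
  symmetric u v with sameEdge? (u , v) (p , q)
  ... | yes uv≈e = trans (setEdge-≈ uv≈e) (sym (setEdge-≈ (SameEdge-swap uv≈e)))
  ... | no uv≉e = trans (setEdge-≉ uv≉e)
    (trans (IsSimple.sym simple u v) (sym (setEdge-≉ (λ vu≈e → uv≉e (SameEdge-swap vu≈e)))))
  irreflexive : ∀ u → setEdge (p , q) b G u u ≡ false
  irreflexive u = trans (setEdge-≉ loop) (IsSimple.irrefl simple u)
    where
    loop : ¬ SameEdge (u , u) (p , q)
    loop (inj₁ (refl , refl)) = p≢q refl
    loop (inj₂ (refl , refl)) = p≢q refl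

count-cong : ∀ {A : Set} {f g : A → Bool} (L : List A) → (∀ {x} → x ∈ L → f x ≡ g x) →
  count f L ≡ count g L
count-cong [] f≗g = refl
count-cong (x ∷ L) f≗g =
  cong₂ (λ a b → indicator a + b) (f≗g (here refl)) (count-cong L (λ x∈ → f≗g (there x∈)))

count-except : ∀ {n} {f g : Fin n → Bool} {c : Fin n} {L} → Unique L → c ∈ L →
  (∀ x → x ≢ c → f x ≡ g x) →
  count f L + indicator (g c) ≡ count g L + indicator (f c)
count-except {f = f} {g} {L = x ∷ L} (x∉L ∷ L!) (here refl) f≗g
  rewrite count-cong {f = f} {g} L (λ x'∈ → f≗g _ (λ x'≡x → All.lookup x∉L x'∈ (sym x'≡x))) =
    exchange (indicator (f x)) (indicator (g x)) (count g L)
  where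
  exchange : ∀ a b c → a + c + b ≡ b + c + a
  exchange = solve-∀
count-except {f = f} {g} {c} {x ∷ L} (x∉L ∷ L!) (there c∈) f≗g with x ≟ c
... | yes refl = ⊥-elim (All.lookup x∉L c∈ refl)
... | no x≢c rewrite f≗g x x≢c = trans (+-assoc (indicator (g x)) _ _)
  (trans (cong (indicator (g x) +_) (count-except L! c∈ f≗g)) (sym (+-assoc (indicator (g x)) _ _)))

degree-setEdge-other : ∀ {m} {e : Edge m} {b G u} → u ≢ proj₁ e → u ≢ proj₂ e →
  degree (setEdge e b G) u ≡ degree G u
degree-setEdge-other {m} u≢p u≢q = count-cong (allFin m) λ _ → setEdge-≉ (λ
  { (inj₁ (u≡p , _)) → u≢p u≡p ; (inj₂ (u≡q , _)) → u≢q u≡q })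

degree-setEdge-end : ∀ {m} {e : Edge m} {b G u c} → SameEdge (u , c) e →
  (∀ {v} → SameEdge (u , v) e → v ≡ c) → degree (setEdge e b G) u + indicator (G u c) ≡ degree G u + indicator b
degree-setEdge-end {m} {e} {b} {G} {u} {c} uc≈e only-c =
  subst (λ k → degree (setEdge e b G) u + indicator (G u c) ≡ degree G u + indicator k) (setEdge-≈ uc≈e)
    (count-except (Unique.allFin⁺ m) (∈-allFin c) λ v v≢c → setEdge-≉ (λ uv≈e → v≢c (only-c uv≈e)))

degree-setEdge-first : ∀ {m} {p q : Fin m} {b G} → p ≢ q →
  degree (setEdge (p , q) b G) p + indicator (G p q) ≡ degree G p + indicator b
degree-setEdge-first p≢q = degree-setEdge-end (inj₁ (refl , refl)) λ
  { (inj₁ (_ , v≡q)) → v≡q ; (inj₂ (p≡q , _)) → ⊥-elim (p≢q p≡q) }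

degree-setEdge-second : ∀ {m} {p q : Fin m} {b G} → p ≢ q →
  degree (setEdge (p , q) b G) q + indicator (G q p) ≡ degree G q + indicator b
degree-setEdge-second p≢q = degree-setEdge-end (inj₂ (refl , refl)) λ
  { (inj₁ (q≡p , _)) → ⊥-elim (p≢q (sym q≡p)) ; (inj₂ (_ , v≡p)) → v≡p }

degree-unsetEdge-first : ∀ {m} {p q : Fin m} {G} → p ≢ q → G p q ≡ true →
  degree (setEdge (p , q) false G) p + 1 ≡ degree G p
degree-unsetEdge-first {p = p} {q} {G} p≢q Gpq =
  trans (cong (λ b → degree (setEdge (p , q) false G) p + indicator b) (sym Gpq))
    (trans (degree-setEdge-first {b = false} {G = G} p≢q) (+-identityʳ _))

degree-unsetEdge-second : ∀ {m} {p q : Fin m} {G} → p ≢ q → G q p ≡ true →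
  degree (setEdge (p , q) false G) q + 1 ≡ degree G q
degree-unsetEdge-second {p = p} {q} {G} p≢q Gqp =
  trans (cong (λ b → degree (setEdge (p , q) false G) q + indicator b) (sym Gqp))
    (trans (degree-setEdge-second {b = false} {G = G} p≢q) (+-identityʳ _))

Reachable-trans : ∀ {m} {G : Adj m} {u w v} → Reachable G u w → Reachable G w v → Reachable G u v
Reachable-trans here w⇝v = w⇝v
Reachable-trans (step Guw' w'⇝w) w⇝v = step Guw' (Reachable-trans w'⇝w w⇝v)

edge⇒Reachable : ∀ {m} {G : Adj m} {u v} → G u v ≡ true → Reachable G u v
edge⇒Reachable Guv = step Guv here

Reachable-sym : ∀ {m} {G : Adj m} → (∀ u v → G u v ≡ G v u) → ∀ {u v} → Reachable G u v → Reachable G v u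
Reachable-sym G-sym here = here
Reachable-sym G-sym {u} (step {w = w} Guw w⇝v) =
  Reachable-trans (Reachable-sym G-sym w⇝v) (edge⇒Reachable (trans (G-sym w u) Guw))

Connected-transfer : ∀ {m} {F F' : Adj m} → Connected F → (∀ u v → F u v ≡ true → Reachable F' u v) →
  Connected F'
Connected-transfer {F = F} {F'} connected edge⇝ u v = transfer (connected u v)
  where
  transfer : ∀ {u v} → Reachable F u v → Reachable F' u v
  transfer here = here
  transfer (step {u = u} {w = w} Fuw w⇝v) = Reachable-trans (edge⇝ u w Fuw) (transfer w⇝v)

trail⇒Reachable : ∀ {m} {G : Adj m} (a : Fin m) rest → EdgesIn G (edgesOf a rest) → Reachable G a (endOf a rest)
trail⇒Reachable a [] _ = here
trail⇒Reachable a (b ∷ rest) (Gab ∷ inG) = step Gab (trail⇒Reachable b rest inG)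

-- Squares and the graph HxP

WithinTwo : ∀ {n} → Adj n → Fin n → Fin n → Set
WithinTwo {n} G u v = G u v ≡ true ⊎ Σ (Fin n) λ w → G u w ≡ true × G w v ≡ true

any-≡true⁺ : ∀ {A : Set} (p : A → Bool) {x} xs → x ∈ xs → p x ≡ true → any p xs ≡ true
any-≡true⁺ p (x ∷ xs) (here refl) px rewrite px = refl
any-≡true⁺ p (x' ∷ xs) (there x∈) px with p x'
... | true  = refl
... | false = any-≡true⁺ p xs x∈ px

any-≡true⁻ : ∀ {A : Set} (p : A → Bool) xs → any p xs ≡ true → Σ A λ x → p x ≡ true
any-≡true⁻ p (x ∷ xs) any≡true with p x in px
... | true  = x , px
... | false = any-≡true⁻ p xs any≡true

Square⁺ : ∀ {n} (G : Adj n) {u v} → u ≢ v → WithinTwo G u v → Square G u v ≡ true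
Square⁺ {n} G {u} {v} u≢v within rewrite ≢⇒== u≢v with G u v in Guv | within
... | true  | _ = refl
... | false | inj₁ false≡true = ⊥-elim (true≢false (sym false≡true))
... | false | inj₂ (w , Guw , Gwv) = any-≡true⁺ _ (allFin n) (∈-allFin w) (cong₂ _∧_ Guw Gwv)

∧-≡true : ∀ {a b} → a ∧ b ≡ true → a ≡ true × b ≡ true
∧-≡true {true} {true} _ = refl , refl

not-≡true : ∀ {a} → not a ≡ true → a ≡ false
not-≡true {false} _ = refl

∨-≡true : ∀ {a b} → a ∨ b ≡ true → a ≡ true ⊎ b ≡ true
∨-≡true {true} _ = inj₁ refl
∨-≡true {false} b≡true = inj₂ b≡true

Square⁻ : ∀ {n} (G : Adj n) {u v} → Square G u v ≡ true → u ≢ v × WithinTwo G u v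
Square⁻ {n} G {u} {v} sq with ∧-≡true {not (u == v)} sq
... | u≠v , within = distinct ,
  Sum.map₂ (λ any≡true → Product.map₂ ∧-≡true (any-≡true⁻ _ (allFin n) any≡true)) (∨-≡true {G u v} within)
  where
  distinct : u ≢ v
  distinct u≡v = true≢false (trans (sym (≡⇒== u≡v)) (not-≡true u≠v))

edgesOf-map : ∀ {m n} (f : Fin m → Fin n) a rest →
  edgesOf (f a) (map f rest) ≡ map (Product.map f f) (edgesOf a rest)
edgesOf-map f a [] = refl
edgesOf-map f a (b ∷ rest) = cong ((f a , f b) ∷_) (edgesOf-map f b rest)

endOf-map : ∀ {m n} (f : Fin m → Fin n) a rest → endOf (f a) (map f rest) ≡ f (endOf a rest)
endOf-map f a [] = refl
endOf-map f a (b ∷ rest) = endOf-map f b rest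

lowerM-inject₁ : ∀ {n} (a : Fin n) → lowerM (inject₁ a) ≡ just a
lowerM-inject₁ {suc n} zero = refl
lowerM-inject₁ {suc n} (suc a) rewrite lowerM-inject₁ a = refl

lowerM-fromℕ : ∀ n → lowerM (fromℕ n) ≡ nothing
lowerM-fromℕ zero = refl
lowerM-fromℕ (suc n) rewrite lowerM-fromℕ n = refl

-- In HxP the new vertex y is fromℕ n and the vertices of H are embedded by inject₁.
module Attached {n} (H : Adj n) (x : Fin n) where

  y : Fin (suc n)
  y = fromℕ n

  ι : Fin n → Fin (suc n)
  ι = inject₁

  K : Adj (suc n)
  K = HxP H x

  ι≢y : ∀ a → ι a ≢ y
  ι≢y a ιa≡y = Fin.fromℕ≢inject₁ (sym ιa≡y)

  K-ι-ι : ∀ a b → K (ι a) (ι b) ≡ H a b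
  K-ι-ι a b rewrite lowerM-inject₁ a | lowerM-inject₁ b = refl

  K-ι-y : ∀ a → K (ι a) y ≡ (a == x)
  K-ι-y a rewrite lowerM-inject₁ a | lowerM-fromℕ n = refl

  K-y-ι : ∀ a → K y (ι a) ≡ (a == x)
  K-y-ι a rewrite lowerM-inject₁ a | lowerM-fromℕ n = refl

  InClosedNbhd : Fin n → Set
  InClosedNbhd a = a ≡ x ⊎ H x a ≡ true

  -- A detour through y could only join x to itself.
  Square-K⇒Square-H : ∀ a b → Square K (ι a) (ι b) ≡ true → Square H a b ≡ true
  Square-K⇒Square-H a b sq with Square⁻ K sq
  ... | ιa≢ιb , inj₁ Kab =
    Square⁺ H (λ a≡b → ιa≢ιb (cong ι a≡b)) (inj₁ (trans (sym (K-ι-ι a b)) Kab))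
  ... | ιa≢ιb , inj₂ (w , Kaw , Kwb) with view w
  ...   | ‵fromℕ = ⊥-elim (ιa≢ιb (cong ι (trans (==⇒≡ (trans (sym (K-ι-y a)) Kaw))
                                             (sym (==⇒≡ (trans (sym (K-y-ι b)) Kwb))))))
  ...   | ‵inject₁ c = Square⁺ H (λ a≡b → ιa≢ιb (cong ι a≡b))
                         (inj₂ (c , trans (sym (K-ι-ι a c)) Kaw , trans (sym (K-ι-ι c b)) Kwb))

  Square-K-y : ∀ v → Square K y v ≡ true → Σ (Fin n) λ a → v ≡ ι a × InClosedNbhd a
  Square-K-y v sq with Square⁻ K sq | view v
  ... | y≢y , _ | ‵fromℕ = ⊥-elim (y≢y refl)
  ... | _ , within | ‵inject₁ a = a , refl , nbhd within
    where
    nbhd : WithinTwo K y (ι a) → InClosedNbhd a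
    nbhd (inj₁ Kya) = inj₁ (==⇒≡ (trans (sym (K-y-ι a)) Kya))
    nbhd (inj₂ (w , Kyw , Kwa)) with view w
    ... | ‵fromℕ rewrite lowerM-fromℕ n = ⊥-elim (true≢false (sym Kyw))
    ... | ‵inject₁ c with ==⇒≡ (trans (sym (K-y-ι c)) Kyw)
    ...   | refl = inj₂ (trans (sym (K-ι-ι x a)) Kwa)

  closedNbhd-clique : IsSimple H → ∀ {a b} → InClosedNbhd a → InClosedNbhd b → a ≢ b →
    Square K (ι a) (ι b) ≡ true
  closedNbhd-clique simple {a} {b} near-a near-b a≢b =
    Square⁺ K (λ ιa≡ιb → a≢b (Fin.inject₁-injective ιa≡ιb)) (within near-a near-b)
    where
    within : InClosedNbhd a → InClosedNbhd b → WithinTwo K (ι a) (ι b)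
    within (inj₁ refl) (inj₁ refl) = ⊥-elim (a≢b refl)
    within (inj₁ refl) (inj₂ Hxb) = inj₁ (trans (K-ι-ι a b) Hxb)
    within (inj₂ Hxa) (inj₁ refl) = inj₁ (trans (K-ι-ι a b) (trans (IsSimple.sym simple a x) Hxa))
    within (inj₂ Hxa) (inj₂ Hxb) =
      inj₂ (ι x , trans (K-ι-ι a x) (trans (IsSimple.sym simple a x) Hxa) , trans (K-ι-ι x b) Hxb)

  lower : Fin (suc n) → Fin n
  lower u = fromMaybe x (lowerM u)

  lower-ι : ∀ a → lower (ι a) ≡ a
  lower-ι a rewrite lowerM-inject₁ a = refl

  ι-lower : ∀ {u} → u ≢ y → ι (lower u) ≡ u
  ι-lower {u} u≢y with view u
  ... | ‵fromℕ = ⊥-elim (u≢y refl)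
  ... | ‵inject₁ a = cong ι (lower-ι a)

  lower-injective : ∀ {u v} → u ≢ y → v ≢ y → lower u ≡ lower v → u ≡ v
  lower-injective u≢y v≢y eq = trans (sym (ι-lower u≢y)) (trans (cong ι eq) (ι-lower v≢y))

  AvoidsY : Edge (suc n) → Set
  AvoidsY (u , v) = u ≢ y × v ≢ y

  EdgesIn-lower : ∀ {es} → EdgesIn (Square K) es → All AvoidsY es →
    EdgesIn (Square H) (map (Product.map lower lower) es)
  EdgesIn-lower [] [] = []
  EdgesIn-lower {(u , v) ∷ _} (sq ∷ inK) ((u≢y , v≢y) ∷ avoid) =
    Square-K⇒Square-H (lower u) (lower v)
      (subst₂ (λ a b → Square K a b ≡ true) (sym (ι-lower u≢y)) (sym (ι-lower v≢y)) sq)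
    ∷ EdgesIn-lower inK avoid

  DistinctEdges-lower : ∀ {es} → DistinctEdges es → All AvoidsY es →
    DistinctEdges (map (Product.map lower lower) es)
  DistinctEdges-lower [] [] = []
  DistinctEdges-lower {e ∷ es} (e≉es ∷ distinct) (e-avoids ∷ avoid) =
    distinct-from es e≉es avoid ∷ DistinctEdges-lower distinct avoid
    where
    same-lower : ∀ {e f} → AvoidsY e → AvoidsY f →
      SameEdge (Product.map lower lower e) (Product.map lower lower f) → SameEdge e f
    same-lower (a≢y , b≢y) (c≢y , d≢y) (inj₁ (ac , bd)) =
      inj₁ (lower-injective a≢y c≢y ac , lower-injective b≢y d≢y bd)
    same-lower (a≢y , b≢y) (c≢y , d≢y) (inj₂ (ad , bc)) =
      inj₂ (lower-injective a≢y d≢y ad , lower-injective b≢y c≢y bc)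
    distinct-from : ∀ fs → All (λ f → ¬ SameEdge e f) fs → All AvoidsY fs →
      All (λ f → ¬ SameEdge (Product.map lower lower e) f) (map (Product.map lower lower) fs)
    distinct-from [] [] [] = []
    distinct-from (f ∷ fs) (e≉f ∷ e≉fs) (f-avoids ∷ avoid) =
      (λ e≈f → e≉f (same-lower e-avoids f-avoids e≈f)) ∷ distinct-from fs e≉fs avoid

  visits-map-lower : ∀ a {L} → All (_≢ y) L → visits a (map lower L) ≡ visits (ι a) L
  visits-map-lower a [] = refl
  visits-map-lower a {u ∷ L} (u≢y ∷ avoid) = cong₂ _+_ same-indicator (visits-map-lower a avoid)
    where
    same-indicator : indicator (lower u == a) ≡ indicator (u == ι a)
    same-indicator with u ≟ ι a
    ... | yes refl rewrite lower-ι a | ≡⇒== (refl {x = a}) = refl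
    ... | no u≢ιa
      rewrite ≢⇒== {u = lower u} {a} (λ eq → u≢ιa (trans (sym (ι-lower u≢y)) (cong ι eq))) = refl

  ∈-map-lower : ∀ a {L} → ι a ∈ L → a ∈ map lower L
  ∈-map-lower a ιa∈ = subst (_∈ _) (lower-ι a) (∈-map⁺ lower ιa∈)

-- Rerouting a factor at a vertex

record AlmostFactor {m} (s : ℕ) (G : Adj m) (y : Fin m) (F : Adj m) : Set where
  field
    simple    : IsSimple F
    sub       : F ⊆ᴳ G
    connected : Connected F
    even      : ∀ u → 2 ∣ degree F u
    bounded   : ∀ u → u ≢ y → degree F u ≤ 2 * s

Factor⇒AlmostFactor : ∀ {m s} {G : Adj m} (factor : Factor s G) (y : Fin m) → AlmostFactor s G y (Factor.F factor)
Factor⇒AlmostFactor factor y = record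
  { simple = Factor.simple factor ; sub = Factor.sub factor ; connected = Factor.connected factor
  ; even = Factor.even factor ; bounded = λ u _ → Factor.bounded factor u }

eulerTour : ∀ {m s} {G : Adj m} {y F} → AlmostFactor s G y F → ∀ z → SpanningClosedTrail F z
eulerTour {F = F} factor = Euler.euler F simple even connected
  where open AlmostFactor factor

Reachable-≈ : ∀ {m} {G : Adj m} → (∀ u v → G u v ≡ G v u) → ∀ {a b u v} →
  SameEdge (u , v) (a , b) → Reachable G a b → Reachable G u v
Reachable-≈ G-sym (inj₁ (refl , refl)) a⇝b = a⇝b
Reachable-≈ G-sym (inj₂ (refl , refl)) a⇝b = Reachable-sym G-sym a⇝b

drop-one-then-toggle : ∀ b {d₀ d₁ d₂} → d₁ + 1 ≡ d₀ → d₂ + indicator b ≡ d₁ + indicator (not b) →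
  d₂ ≡ d₀ ⊎ d₂ + 2 ≡ d₀
drop-one-then-toggle true  {d₂ = d₂} refl eq =
  inj₂ (trans (sym (+-assoc d₂ 1 1)) (cong (_+ 1) (trans eq (+-identityʳ _))))
drop-one-then-toggle false {d₂ = d₂} refl eq = inj₁ (trans (sym (+-identityʳ d₂)) eq)

-- Replace the edges yp and yq of F by pq, or, if pq is already an edge, delete all three.
module Reroute {m} {F : Adj m} (simple : IsSimple F) {y p q : Fin m}
               (p≢q : p ≢ q) (Fyp : F y p ≡ true) (Fyq : F y q ≡ true) where

  private
    y≢p = adjacent⇒≢ simple Fyp
    y≢q = adjacent⇒≢ simple Fyq
    F-sym = IsSimple.sym simple
    F₁ = setEdge (y , p) false F
    F₂ = setEdge (y , q) false F₁

  F' : Adj m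
  F' = setEdge (p , q) (not (F p q)) F₂

  F'-simple : IsSimple F'
  F'-simple = setEdge-simple p≢q (setEdge-simple y≢q (setEdge-simple y≢p simple))

  F'⊆F+pq : ∀ {u v} → F' u v ≡ true → SameEdge (u , v) (p , q) ⊎ F u v ≡ true
  F'⊆F+pq {u} {v} F'uv with sameEdge? (u , v) (p , q) | sameEdge? (u , v) (y , q) | sameEdge? (u , v) (y , p)
  ... | yes uv≈pq | _ | _ = inj₁ uv≈pq
  ... | no uv≉pq | yes uv≈yq | _ =
    ⊥-elim (true≢false (trans (sym F'uv) (trans (setEdge-≉ uv≉pq) (setEdge-≈ uv≈yq))))
  ... | no uv≉pq | no uv≉yq | yes uv≈yp =
    ⊥-elim (true≢false
      (trans (sym F'uv) (trans (setEdge-≉ uv≉pq) (trans (setEdge-≉ uv≉yq) (setEdge-≈ uv≈yp)))))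
  ... | no uv≉pq | no uv≉yq | no uv≉yp =
    inj₂ (trans (sym (trans (setEdge-≉ uv≉pq) (trans (setEdge-≉ uv≉yq) (setEdge-≉ uv≉yp)))) F'uv)

  keeps : ∀ {u v} → F u v ≡ true → ¬ SameEdge (u , v) (y , p) → ¬ SameEdge (u , v) (y , q) →
    ¬ SameEdge (u , v) (p , q) → F' u v ≡ true
  keeps Fuv uv≉yp uv≉yq uv≉pq =
    trans (setEdge-≉ uv≉pq) (trans (setEdge-≉ uv≉yq) (trans (setEdge-≉ uv≉yp) Fuv))

  keeps-at-y : ∀ {w} → F y w ≡ true → w ≢ p → w ≢ q → F' y w ≡ true
  keeps-at-y Fyw w≢p w≢q = keeps Fyw
    (λ { (inj₁ (_ , w≡p)) → w≢p w≡p ; (inj₂ (y≡p , _)) → y≢p y≡p })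
    (λ { (inj₁ (_ , w≡q)) → w≢q w≡q ; (inj₂ (y≡q , _)) → y≢q y≡q })
    (λ { (inj₁ (y≡p , _)) → y≢p y≡p ; (inj₂ (y≡q , _)) → y≢q y≡q })

  keeps-outside : ∀ {w z} → F w z ≡ true → w ≢ y → w ≢ p → w ≢ q → F' w z ≡ true
  keeps-outside Fwz w≢y w≢p w≢q = keeps Fwz
    (λ { (inj₁ (w≡y , _)) → w≢y w≡y ; (inj₂ (w≡p , _)) → w≢p w≡p })
    (λ { (inj₁ (w≡y , _)) → w≢y w≡y ; (inj₂ (w≡q , _)) → w≢q w≡q })
    (λ { (inj₁ (w≡p , _)) → w≢p w≡p ; (inj₂ (w≡q , _)) → w≢q w≡q })

  keeps-off-y : F p q ≡ false → ∀ {u v} → u ≢ y → v ≢ y → F u v ≡ true → F' u v ≡ true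
  keeps-off-y Fpq {u} {v} u≢y v≢y Fuv with sameEdge? (u , v) (p , q)
  ... | yes uv≈pq = trans (setEdge-≈ uv≈pq) (cong not Fpq)
  ... | no uv≉pq = keeps Fuv (λ { (inj₁ (u≡y , _)) → u≢y u≡y ; (inj₂ (_ , v≡y)) → v≢y v≡y })
                             (λ { (inj₁ (u≡y , _)) → u≢y u≡y ; (inj₂ (_ , v≡y)) → v≢y v≡y }) uv≉pq

  F'-connected : Connected F → Reachable F' y p → Reachable F' y q → Connected F'
  F'-connected connected y⇝p y⇝q = Connected-transfer connected edge⇝
    where
    F'-sym = IsSimple.sym F'-simple
    edge⇝ : ∀ u v → F u v ≡ true → Reachable F' u v
    edge⇝ u v Fuv with sameEdge? (u , v) (y , p) | sameEdge? (u , v) (y , q) | sameEdge? (u , v) (p , q)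
    ... | yes uv≈yp | _ | _ = Reachable-≈ F'-sym uv≈yp y⇝p
    ... | no _ | yes uv≈yq | _ = Reachable-≈ F'-sym uv≈yq y⇝q
    ... | no _ | no _ | yes uv≈pq = Reachable-≈ F'-sym uv≈pq (Reachable-trans (Reachable-sym F'-sym y⇝p) y⇝q)
    ... | no uv≉yp | no uv≉yq | no uv≉pq = edge⇒Reachable (keeps Fuv uv≉yp uv≉yq uv≉pq)

  private
    F₁y : degree F₁ y + 1 ≡ degree F y
    F₁y = degree-unsetEdge-first y≢p Fyp
    F₁p : degree F₁ p + 1 ≡ degree F p
    F₁p = degree-unsetEdge-second y≢p (trans (F-sym p y) Fyp)
    F₁yq : F₁ y q ≡ true
    F₁yq = trans (setEdge-≉ λ { (inj₁ (_ , q≡p)) → p≢q (sym q≡p) ; (inj₂ (y≡p , _)) → y≢p y≡p }) Fyq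
    F₂y : degree F₂ y + 1 ≡ degree F₁ y
    F₂y = degree-unsetEdge-first y≢q F₁yq
    F₂q : degree F₂ q + 1 ≡ degree F₁ q
    F₂q = degree-unsetEdge-second y≢q (trans (IsSimple.sym (setEdge-simple y≢p simple) q y) F₁yq)
    F₂-pq : ∀ {u v} → u ≢ y → v ≢ y → F₂ u v ≡ F u v
    F₂-pq u≢y v≢y = trans (setEdge-≉ (avoid u≢y v≢y)) (setEdge-≉ (avoid u≢y v≢y))
      where
      avoid : ∀ {u v w} → u ≢ y → v ≢ y → ¬ SameEdge (u , v) (y , w)
      avoid u≢y _ (inj₁ (u≡y , _)) = u≢y u≡y
      avoid _ v≢y (inj₂ (_ , v≡y)) = v≢y v≡y
    F'p : degree F' p + indicator (F p q) ≡ degree F₂ p + indicator (not (F p q))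
    F'p = trans (cong (λ b → degree F' p + indicator b) (sym (F₂-pq (y≢p ∘ sym) (y≢q ∘ sym))))
                (degree-setEdge-first {b = not (F p q)} {G = F₂} p≢q)
    F'q : degree F' q + indicator (F p q) ≡ degree F₂ q + indicator (not (F p q))
    F'q = trans (cong (λ b → degree F' q + indicator b)
                      (sym (trans (F₂-pq (y≢q ∘ sym) (y≢p ∘ sym)) (F-sym q p))))
                (degree-setEdge-second {b = not (F p q)} {G = F₂} p≢q)

  degree-F'-y : degree F' y + 2 ≡ degree F y
  degree-F'-y = begin
    degree F' y + 2      ≡⟨ cong (_+ 2) (degree-setEdge-other {b = not (F p q)} {G = F₂} y≢p y≢q) ⟩
    degree F₂ y + 2      ≡⟨ +-assoc (degree F₂ y) 1 1 ⟨
    degree F₂ y + 1 + 1  ≡⟨ cong (_+ 1) F₂y ⟩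
    degree F₁ y + 1      ≡⟨ F₁y ⟩
    degree F y           ∎
    where open ≡-Reasoning

  degree-F' : ∀ u → degree F' u ≡ degree F u ⊎ degree F' u + 2 ≡ degree F u
  degree-F' u with u ≟ y | u ≟ p | u ≟ q
  ... | yes refl | _ | _ = inj₂ degree-F'-y
  ... | no u≢y | yes refl | _ =
    drop-one-then-toggle (F p q) (trans (cong (_+ 1) (degree-setEdge-other {e = (y , q)} (u≢y) p≢q)) F₁p) F'p
  ... | no u≢y | no u≢p | yes refl =
    drop-one-then-toggle (F p q) (trans F₂q (degree-setEdge-other u≢y u≢p)) F'q
  ... | no u≢y | no u≢p | no u≢q = inj₁ (trans (degree-setEdge-other u≢p u≢q)
    (trans (degree-setEdge-other u≢y u≢q) (degree-setEdge-other u≢y u≢p)))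

  F'-AlmostFactor : ∀ {s G} → AlmostFactor s G y F → G p q ≡ true → G q p ≡ true →
    Reachable F' y p → Reachable F' y q → AlmostFactor s G y F'
  F'-AlmostFactor {s} {G} factor Gpq Gqp y⇝p y⇝q = record
    { simple = F'-simple ; sub = sub ; connected = F'-connected (AlmostFactor.connected factor) y⇝p y⇝q
    ; even = even ; bounded = bounded }
    where
    sub : F' ⊆ᴳ G
    sub u v F'uv with F'⊆F+pq F'uv
    ... | inj₁ (inj₁ (refl , refl)) = Gpq
    ... | inj₁ (inj₂ (refl , refl)) = Gqp
    ... | inj₂ Fuv = AlmostFactor.sub factor u v Fuv
    even : ∀ u → 2 ∣ degree F' u
    even u with degree-F' u
    ... | inj₁ same = subst (2 ∣_) (sym same) (AlmostFactor.even factor u)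
    ... | inj₂ dropped =
      ∣m+n∣m⇒∣n (subst (2 ∣_) (trans (sym dropped) (+-comm (degree F' u) 2)) (AlmostFactor.even factor u)) ∣-refl
    bounded : ∀ u → u ≢ y → degree F' u ≤ 2 * s
    bounded u u≢y with degree-F' u
    ... | inj₁ same = subst (_≤ 2 * s) (sym same) (AlmostFactor.bounded factor u u≢y)
    ... | inj₂ dropped =
      ≤-trans (m≤m+n (degree F' u) 2) (subst (_≤ 2 * s) (sym dropped) (AlmostFactor.bounded factor u u≢y))

-- Descent on the degree of y

firstSplit : ∀ {m} (z : Fin m) {L} → z ∈ L →
  Σ (List (Fin m)) λ P → Σ (List (Fin m)) λ Q → L ≡ P ++ z ∷ Q × z ∉ P
firstSplit z {u ∷ L} z∈ with u ≟ z
... | yes refl = [] , L , refl , λ ()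
firstSplit z {u ∷ L} (here z≡u) | no u≢z = ⊥-elim (u≢z (sym z≡u))
firstSplit z {u ∷ L} (there z∈) | no u≢z with firstSplit z z∈
... | P , Q , refl , z∉P = u ∷ P , Q , refl , λ { (here z≡u) → u≢z (sym z≡u) ; (there z∈P) → z∉P z∈P }

edgesOf-loop : ∀ {m} (y a : Fin m) P Q →
  edgesOf y (a ∷ P ++ y ∷ Q) ≡ (y , a) ∷ edgesOf a P ++ (endOf a P , y) ∷ edgesOf y Q
edgesOf-loop y a P Q = cong ((y , a) ∷_) (edgesOf-++ a P (y ∷ Q))

DistinctEdges-after : ∀ {m} xs {e : Edge m} {ys f} → DistinctEdges (xs ++ e ∷ ys) → f ∈ ys → ¬ SameEdge e f
DistinctEdges-after xs distinct f∈ with AllPairs-++⁻ xs distinct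
... | _ , (e≉ys ∷ _) , _ = All.lookup e≉ys f∈

module Descent {n} (s : ℕ) (H : Adj n) (H-simple : IsSimple H) (x : Fin n) where
  open Attached H x

  Goal : Set
  Goal = Σ (Fin n) λ x' → Σ (Fin n) λ x'' →
    (x' ≡ x ⊎ H x x' ≡ true) × H x x'' ≡ true × SpanningSTrail (Square H) s x' x''

  Admissible : Adj (suc n) → Set
  Admissible = AlmostFactor s (Square K) y

  avoid-∈ : ∀ {L} → y ∉ L → All (_≢ y) L
  avoid-∈ y∉ = All.tabulate λ t∈ t≡y → y∉ (subst (_∈ _) t≡y t∈)

  record TrailOffY (F : Adj (suc n)) (a : Fin (suc n)) (rest : List (Fin (suc n))) : Set where
    field
      trail    : IsTrail F a rest
      avoids   : All (_≢ y) (a ∷ rest)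
      spans    : ∀ t → t ≢ y → t ∈ a ∷ rest
      visits-≤ : ∀ t → t ≢ y → visits t (a ∷ rest) ≤ s

  TrailOffY-reversed : ∀ {F a rest} → IsSimple F → TrailOffY F a rest → TrailOffY F (endOf a rest) (reversed a rest)
  TrailOffY-reversed {a = a} {rest} simple offY = record
    { trail    = IsTrail-reversed (IsSimple.sym simple) trail
    ; avoids   = All.tabulate λ t∈ → All.lookup avoids (reversed-⊆ a rest t∈)
    ; spans    = λ t t≢y → reversed-⊇ a rest (spans t t≢y)
    ; visits-≤ = λ t t≢y → subst (_≤ s) (sym (visits-reversed t a rest)) (visits-≤ t t≢y)
    }
    where open TrailOffY offY

  lowerTrail : ∀ {F a rest} → Admissible F → TrailOffY F a rest →
    SpanningSTrail (Square H) s (lower a) (lower (endOf a rest))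
  lowerTrail {a = a} {rest} af offY = record
    { rest     = map lower rest
    ; edges    = subst (EdgesIn (Square H)) (sym (edgesOf-map lower a rest))
                   (EdgesIn-lower (All.map (λ {e} → AlmostFactor.sub af (proj₁ e) (proj₂ e)) (proj₁ trail))
                                  avoidsEdges)
    ; distinct = subst DistinctEdges (sym (edgesOf-map lower a rest)) (DistinctEdges-lower (proj₂ trail) avoidsEdges)
    ; ends     = endOf-map lower a rest
    ; spanning = λ v → ∈-map-lower v (spans (ι v) (ι≢y v))
    ; atMost   = λ v → subst (_≤ s) (sym (visits-map-lower v avoids)) (visits-≤ (ι v) (ι≢y v))
    }
    where
    open TrailOffY offY
    avoidsEdges : All AvoidsY (edgesOf a rest)
    avoidsEdges = All.tabulate λ e∈ →
      let u∈ , v∈ = ∈-edgesOf⇒∈ a rest e∈ in All.lookup avoids u∈ , All.lookup avoids v∈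

  record OneLoop (F : Adj (suc n)) : Set where
    field
      a    : Fin (suc n)
      rest : List (Fin (suc n))
      offY : TrailOffY F a rest
      Fya  : F y a ≡ true
      Fyb  : F y (endOf a rest) ≡ true
      a≢b  : a ≢ endOf a rest

  nbhd-of-y : ∀ {F} → Admissible F → ∀ {v} → F y v ≡ true → InClosedNbhd (lower v)
  nbhd-of-y af {v} Fyv with Square-K-y v (AlmostFactor.sub af y v Fyv)
  ... | a , refl , near = subst InClosedNbhd (sym (lower-ι a)) near

  open-nbhd : ∀ {c} → InClosedNbhd c → c ≢ x → H x c ≡ true
  open-nbhd (inj₁ c≡x) c≢x = ⊥-elim (c≢x c≡x)
  open-nbhd (inj₂ Hxc) _ = Hxc

  -- Of the two ends of the trail one lies in N(x) since they differ; start at the other.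
  finish : ∀ {F} → Admissible F → OneLoop F → Goal
  finish af loop = orient (lower (endOf a rest) ≟ x)
    where
    open OneLoop loop
    orient : Dec (lower (endOf a rest) ≡ x) → Goal
    orient (no b≢x) =
      lower a , lower (endOf a rest) , nbhd-of-y af Fya , open-nbhd (nbhd-of-y af Fyb) b≢x , lowerTrail af offY
    orient (yes b≡x) =
      lower (endOf a rest) , lower a , nbhd-of-y af Fyb , open-nbhd (nbhd-of-y af Fya) a≢x ,
      subst (SpanningSTrail (Square H) s _) (cong lower (endOf-reversed a rest))
        (lowerTrail af (TrailOffY-reversed (AlmostFactor.simple af) offY))
      where
      a≢x : lower a ≢ x
      a≢x a≡x = a≢b (lower-injective (All.lookup (TrailOffY.avoids offY) (here refl))
                                     (All.lookup (TrailOffY.avoids offY) (endOf-∈ a rest)) (trans a≡x (sym b≡x)))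

  returnsToY : ∀ {rest} → endOf y rest ≡ y → ι x ∈ y ∷ rest → y ∈ rest
  returnsToY {[]} _ (here ιx≡y) = ⊥-elim (ι≢y x ιx≡y)
  returnsToY {r ∷ rs} closes _ = subst (_∈ r ∷ rs) closes (endOf-∈ r rs)

  KeepsOffY : Adj (suc n) → Adj (suc n) → Set
  KeepsOffY F F' = ∀ {u v} → u ≢ y → v ≢ y → F u v ≡ true → F' u v ≡ true

  -- A walk of F avoiding y, in the form in which it survives rerouting at y.
  JoinedOffY : Adj (suc n) → Fin (suc n) → Fin (suc n) → Set
  JoinedOffY F u v = ∀ {F'} → IsSimple F' → KeepsOffY F F' → Reachable F' u v

  JoinedOffY-sym : ∀ {F u v} → JoinedOffY F u v → JoinedOffY F v u
  JoinedOffY-sym u⇝v simple keeps = Reachable-sym (IsSimple.sym simple) (u⇝v simple keeps)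

  segment-joined : ∀ {F} a P → EdgesIn F (edgesOf a P) → y ∉ a ∷ P → JoinedOffY F a (endOf a P)
  segment-joined a P inF y∉ _ keeps = trail⇒Reachable a P (All.tabulate λ e∈ →
    let u∈ , v∈ = ∈-edgesOf⇒∈ a P e∈
    in keeps (All.lookup (avoid-∈ y∉) u∈) (All.lookup (avoid-∈ y∉) v∈) (All.lookup inF e∈))

  record TwoLoops (F : Adj (suc n)) : Set where
    field
      a₁ b₁ a₂ b₂ : Fin (suc n)
      Fya₁ : F y a₁ ≡ true
      Fyb₁ : F y b₁ ≡ true
      Fya₂ : F y a₂ ≡ true
      Fyb₂ : F y b₂ ≡ true
      a₁≢b₁ : a₁ ≢ b₁
      a₁≢a₂ : a₁ ≢ a₂
      a₁≢b₂ : a₁ ≢ b₂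
      b₁≢a₂ : b₁ ≢ a₂
      b₁≢b₂ : b₁ ≢ b₂
      a₂≢b₂ : a₂ ≢ b₂
      a₁⇝b₁ : JoinedOffY F a₁ b₁
      a₂⇝b₂ : JoinedOffY F a₂ b₂

  module _ {F} (af : Admissible F) where

    private
      F-sym = IsSimple.sym (AlmostFactor.simple af)

      no-loop-at-y : F y y ≢ true
      no-loop-at-y Fyy = true≢false (trans (sym Fyy) (IsSimple.irrefl (AlmostFactor.simple af) y))

    oneLoop : ∀ a P → IsClosedTrail F y (a ∷ P ++ [ y ]) → (∀ t → t ∈ y ∷ a ∷ P ++ [ y ]) →
      y ∉ a ∷ P → OneLoop F
    oneLoop a P closed@((inG , distinct) , _) spanning y∉ = record
      { a = a ; rest = P ; offY = offY ; Fya = Fya ; Fyb = trans (F-sym y b) Fby ; a≢b = a≢b }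
      where
      E = edgesOf a P
      b = endOf a P
      inG' : EdgesIn F ((y , a) ∷ E ++ [ (b , y) ])
      inG' = subst (EdgesIn F) (edgesOf-loop y a P []) inG
      distinct' : DistinctEdges ((y , a) ∷ E ++ [ (b , y) ])
      distinct' = subst DistinctEdges (edgesOf-loop y a P []) distinct
      Fya : F y a ≡ true
      Fya = All.head inG'
      Fby : F b y ≡ true
      Fby = All.lookup inG' (there (∈-++⁺ʳ E (here refl)))
      a≢b : a ≢ b
      a≢b a≡b = DistinctEdges-after [] distinct' (∈-++⁺ʳ E (here refl)) (inj₂ (refl , a≡b))
      spans : ∀ t → t ≢ y → t ∈ a ∷ P
      spans t t≢y with spanning t
      ... | here t≡y = ⊥-elim (t≢y t≡y)
      ... | there t∈ with ∈-++⁻ (a ∷ P) t∈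
      ...   | inj₁ t∈aP = t∈aP
      ...   | inj₂ (here t≡y) = ⊥-elim (t≢y t≡y)
      visits-≤ : ∀ t → t ≢ y → visits t (a ∷ P) ≤ s
      visits-≤ t t≢y = *-cancelˡ-≤ 2 (begin
        2 * visits t (a ∷ P)                 ≤⟨ *-monoʳ-≤ 2 visits-mono ⟩
        2 * visits t (y ∷ a ∷ P ++ [ y ])    ≤⟨ visits-≤-degree (AlmostFactor.simple af) closed t t≢y ⟩
        degree F t                           ≤⟨ AlmostFactor.bounded af t t≢y ⟩
        2 * s                                ∎)
        where
        open ≤-Reasoning
        visits-mono : visits t (a ∷ P) ≤ visits t (y ∷ a ∷ P ++ [ y ])
        visits-mono rewrite ≢⇒== (λ y≡t → t≢y (sym y≡t)) | visits-++ t (a ∷ P) [ y ] = m≤m+n _ _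
      offY : TrailOffY F a P
      offY = record
        { trail    = All.++⁻ˡ E (All.tail inG') , proj₁ (AllPairs-++⁻ E (AllPairs.tail distinct'))
        ; avoids   = avoid-∈ y∉
        ; spans    = spans
        ; visits-≤ = visits-≤
        }

    twoLoops : ∀ a₁ P₁ a₂ P₂ R → IsTrail F y (a₁ ∷ P₁ ++ y ∷ a₂ ∷ P₂ ++ y ∷ R) →
      y ∉ a₁ ∷ P₁ → y ∉ a₂ ∷ P₂ → TwoLoops F
    twoLoops a₁ P₁ a₂ P₂ R (inG , distinct) y∉₁ y∉₂ = record
      { a₁ = a₁ ; b₁ = b₁ ; a₂ = a₂ ; b₂ = b₂
      ; Fya₁ = All.head inG'
      ; Fyb₁ = trans (F-sym y b₁) (All.lookup inG' (there b₁y∈))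
      ; Fya₂ = All.lookup inG' (there ya₂∈)
      ; Fyb₂ = trans (F-sym y b₂) (All.lookup inG' (there b₂y∈))
      ; a₁≢b₁ = λ eq → DistinctEdges-after [] distinct' b₁y∈ (inj₂ (refl , eq))
      ; a₁≢a₂ = λ eq → DistinctEdges-after [] distinct' ya₂∈ (inj₁ (refl , eq))
      ; a₁≢b₂ = λ eq → DistinctEdges-after [] distinct' b₂y∈ (inj₂ (refl , eq))
      ; b₁≢a₂ = λ eq → DistinctEdges-after [] distinct₂ (here refl) (inj₂ (eq , refl))
      ; b₁≢b₂ = λ eq → DistinctEdges-after [] distinct₂ (there b₂y∈L₂) (inj₁ (eq , refl))
      ; a₂≢b₂ = λ eq → DistinctEdges-after [ (b₁ , y) ] distinct₂ b₂y∈L₂ (inj₂ (refl , eq))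
      ; a₁⇝b₁ = segment-joined a₁ P₁ (All.++⁻ˡ E₁ (All.tail inG')) y∉₁
      ; a₂⇝b₂ = segment-joined a₂ P₂ (All.++⁻ˡ E₂ (All.tail (All.tail (All.++⁻ʳ E₁ (All.tail inG'))))) y∉₂
      }
      where
      b₁ = endOf a₁ P₁
      b₂ = endOf a₂ P₂
      E₁ = edgesOf a₁ P₁
      E₂ = edgesOf a₂ P₂
      L₂ = E₂ ++ (b₂ , y) ∷ edgesOf y R
      L = (y , a₁) ∷ E₁ ++ (b₁ , y) ∷ (y , a₂) ∷ L₂
      layout : edgesOf y (a₁ ∷ P₁ ++ y ∷ a₂ ∷ P₂ ++ y ∷ R) ≡ L
      layout = trans (edgesOf-loop y a₁ P₁ (a₂ ∷ P₂ ++ y ∷ R))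
        (cong (λ es → (y , a₁) ∷ E₁ ++ (b₁ , y) ∷ es) (edgesOf-loop y a₂ P₂ R))
      inG' : EdgesIn F L
      inG' = subst (EdgesIn F) layout inG
      distinct' : DistinctEdges L
      distinct' = subst DistinctEdges layout distinct
      distinct₂ : DistinctEdges ((b₁ , y) ∷ (y , a₂) ∷ L₂)
      distinct₂ = proj₁ (proj₂ (AllPairs-++⁻ E₁ (AllPairs.tail distinct')))
      b₂y∈L₂ : (b₂ , y) ∈ L₂
      b₂y∈L₂ = ∈-++⁺ʳ E₂ (here refl)
      b₁y∈ : (b₁ , y) ∈ E₁ ++ (b₁ , y) ∷ (y , a₂) ∷ L₂
      b₁y∈ = ∈-++⁺ʳ E₁ (here refl)
      ya₂∈ : (y , a₂) ∈ E₁ ++ (b₁ , y) ∷ (y , a₂) ∷ L₂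
      ya₂∈ = ∈-++⁺ʳ E₁ (there (here refl))
      b₂y∈ : (b₂ , y) ∈ E₁ ++ (b₁ , y) ∷ (y , a₂) ∷ L₂
      b₂y∈ = ∈-++⁺ʳ E₁ (there (there b₂y∈L₂))

    afterFirstReturn : ∀ a₁ P₁ Q → y ∉ a₁ ∷ P₁ → IsClosedTrail F y (a₁ ∷ P₁ ++ y ∷ Q) →
      (∀ t → t ∈ y ∷ a₁ ∷ P₁ ++ y ∷ Q) → OneLoop F ⊎ TwoLoops F
    afterFirstReturn a₁ P₁ [] y∉₁ closed spanning = inj₁ (oneLoop a₁ P₁ closed spanning y∉₁)
    afterFirstReturn a₁ P₁ (q ∷ Q) y∉₁ (trail , closes) _
      with firstSplit y (subst (_∈ q ∷ Q) (trans (sym (endOf-++ a₁ P₁ (y ∷ q ∷ Q))) closes) (endOf-∈ q Q))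
    ... | [] , _ , refl , _ = ⊥-elim (no-loop-at-y
      (All.lookup (subst (EdgesIn F) (edgesOf-loop y a₁ P₁ (y ∷ _)) (proj₁ trail))
                  (there (∈-++⁺ʳ (edgesOf a₁ P₁) (there (here refl))))))
    ... | a₂ ∷ P₂ , R , refl , y∉₂ = inj₂ (twoLoops a₁ P₁ a₂ P₂ R trail y∉₁ y∉₂)

    -- Cut the Euler tour at its first two returns to y.
    tourShape : SpanningClosedTrail F y → OneLoop F ⊎ TwoLoops F
    tourShape record { rest = rest ; closed = closed ; spanning = spanning }
      with firstSplit y (returnsToY (proj₂ closed) (spanning (ι x)))
    ... | [] , _ , refl , _ = ⊥-elim (no-loop-at-y (All.head (proj₁ (proj₁ closed))))
    ... | a₁ ∷ P₁ , Q , refl , y∉₁ = afterFirstReturn a₁ P₁ Q y∉₁ closed spanning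

    Smaller : Set
    Smaller = Σ (Adj (suc n)) λ F' → Admissible F' × degree F' y + 2 ≡ degree F y

    K²-between : ∀ {p q} → p ≢ q → F y p ≡ true → F y q ≡ true → Square K p q ≡ true
    K²-between {p} {q} p≢q Fyp Fyq
      with Square-K-y p (AlmostFactor.sub af y p Fyp) | Square-K-y q (AlmostFactor.sub af y q Fyq)
    ... | a , refl , near-a | b , refl , near-b =
      closedNbhd-clique H-simple near-a near-b (λ a≡b → p≢q (cong ι a≡b))

    module _ {p q} (p≢q : p ≢ q) (Fyp : F y p ≡ true) (Fyq : F y q ≡ true) where
      open Reroute (AlmostFactor.simple af) p≢q Fyp Fyq

      rerouteAt : Reachable F' y p → Reachable F' y q → Smaller
      rerouteAt y⇝p y⇝q =
        F' , F'-AlmostFactor af (K²-between p≢q Fyp Fyq) (K²-between (p≢q ∘ sym) Fyq Fyp) y⇝p y⇝q , degree-F'-y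

      -- pq is added, and p, q stay reachable from y through the loops they close.
      rerouteAdding : F p q ≡ false → ∀ {p' q'} → F y p' ≡ true → F y q' ≡ true →
        p' ≢ p → p' ≢ q → q' ≢ p → q' ≢ q → JoinedOffY F p' p → JoinedOffY F q' q → Smaller
      rerouteAdding Fpq Fyp' Fyq' p'≢p p'≢q q'≢p q'≢q p'⇝p q'⇝q = rerouteAt
        (step (keeps-at-y Fyp' p'≢p p'≢q) (p'⇝p F'-simple (keeps-off-y Fpq)))
        (step (keeps-at-y Fyq' q'≢p q'≢q) (q'⇝q F'-simple (keeps-off-y Fpq)))

      -- p and q stay reachable from y through two further common neighbours.
      rerouteVia : ∀ {p' q'} → F y p' ≡ true → F y q' ≡ true → p' ≢ p → p' ≢ q → q' ≢ p → q' ≢ q →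
        F p' p ≡ true → F q' q ≡ true → Smaller
      rerouteVia Fyp' Fyq' p'≢p p'≢q q'≢p q'≢q Fp'p Fq'q = rerouteAt
        (step (keeps-at-y Fyp' p'≢p p'≢q) (edge⇒Reachable (keeps-outside Fp'p (y≢ Fyp') p'≢p p'≢q)))
        (step (keeps-at-y Fyq' q'≢p q'≢q) (edge⇒Reachable (keeps-outside Fq'q (y≢ Fyq') q'≢p q'≢q)))
        where
        y≢ : ∀ {w} → F y w ≡ true → w ≢ y
        y≢ Fyw w≡y = adjacent⇒≢ (AlmostFactor.simple af) Fyw (sym w≡y)

    -- Among the four neighbours a₁, b₁, a₂, b₂ of y either some pair across the two loops
    -- is a non-edge, which then replaces its two edges to y, or all four such pairs are
    -- edges, and the triangle y a₁ a₂ can be deleted.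
    module _ (loops : TwoLoops F) where
      open TwoLoops loops

      reduce : Smaller
      reduce with F a₁ a₂ in e₁ | F a₁ b₂ in e₂ | F b₁ a₂ in e₃ | F b₁ b₂ in e₄
      ... | false | _ | _ | _ =
        rerouteAdding a₁≢a₂ Fya₁ Fya₂ e₁ Fyb₁ Fyb₂ (≢-sym a₁≢b₁) b₁≢a₂ (≢-sym a₁≢b₂) (≢-sym a₂≢b₂)
          (JoinedOffY-sym a₁⇝b₁) (JoinedOffY-sym a₂⇝b₂)
      ... | true | false | _ | _ =
        rerouteAdding a₁≢b₂ Fya₁ Fyb₂ e₂ Fyb₁ Fya₂ (≢-sym a₁≢b₁) b₁≢b₂ (≢-sym a₁≢a₂) a₂≢b₂
          (JoinedOffY-sym a₁⇝b₁) a₂⇝b₂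
      ... | true | true | false | _ =
        rerouteAdding b₁≢a₂ Fyb₁ Fya₂ e₃ Fya₁ Fyb₂ a₁≢b₁ a₁≢a₂ (≢-sym b₁≢b₂) (≢-sym a₂≢b₂)
          a₁⇝b₁ (JoinedOffY-sym a₂⇝b₂)
      ... | true | true | true | false =
        rerouteAdding b₁≢b₂ Fyb₁ Fyb₂ e₄ Fya₁ Fya₂ a₁≢b₁ a₁≢b₂ (≢-sym b₁≢a₂) a₂≢b₂ a₁⇝b₁ a₂⇝b₂
      ... | true | true | true | true =
        rerouteVia a₁≢a₂ Fya₁ Fya₂ Fyb₂ Fyb₁ (≢-sym a₁≢b₂) (≢-sym a₂≢b₂) (≢-sym a₁≢b₁) b₁≢a₂
          (trans (F-sym b₂ a₁) e₂) e₃

  descend : ∀ fuel {F} → Admissible F → degree F y ≤ fuel → Goal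
  descend fuel af bound with tourShape af (eulerTour af y)
  ... | inj₁ loop = finish af loop
  ... | inj₂ loops with reduce af loops
  ...   | F' , af' , dropped = next fuel (subst (_≤ fuel) (sym (trans (+-comm 2 (degree F' y)) dropped)) bound)
    where
    next : ∀ fuel → 2 + degree F' y ≤ fuel → Goal
    next (suc fuel') (s≤s bound') = descend fuel' af' (≤-trans (n≤1+n _) bound')

lemma5 : (s : ℕ) → 1 ≤ s → (n : ℕ) → (H : Adj n) → IsSimple H → Connected H → (x : Fin n) →
    Factor s (Square (HxP H x)) →
    Σ (Fin n) λ x' → Σ (Fin n) λ x'' →
      (x' ≡ x ⊎ H x x' ≡ true) × H x x'' ≡ true × SpanningSTrail (Square H) s x' x''
lemma5 s _ n H simple _ x factor =
  Descent.descend s H simple x (degree (Factor.F factor) y) (Factor⇒AlmostFactor factor y) ≤-refl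
  where open Attached H x using (y)
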